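{- Let $\lambda\in\mathbb{C}_p$ with $\lambda\ne0$ and $|\lambda|_p\le1$ ($p$ an odd prime). For every $n\ge0$, \[ \sum_{l=0}^n S_1(n,l)\,\mathcal{E}_{l,\lambda}(x)=Ch_{n,\lambda}(x). \]
   Context: $S_1(n,l)$ are the (signed) Stirling numbers of the first kind: $x(x-1)\cdots(x-n+1)=\sum_{l=0}^nS_1(n,l)x^l$. Write $(x)_{0,\lambda}=1$, $(x)_{n,\lambda}=x(x-\lambda)\cdots(x-(n-1)\lambda)$, and $(1+\lambda u)^{x/\lambda}=\sum_{m\ge0}(x)_{m,\lambda}u^m/m!$. Carlitz's degenerate Euler polynomials are defined by $\frac{2}{(1+\lambda t)^{1/\lambda}+1}(1+\lambda t)^{x/\lambda}=\sum_{n\ge0}\mathcal{E}_{n,\lambda}(x)\frac{t^n}{n!}$. The degenerate Changhee polynomials of the second kind are defined by $\frac{2}{1+(1+\lambda\log(1+t))^{1/\lambda}}(1+\lambda\log(1+t))^{x/\lambda}=\sum_{n\ge0}Ch_{n,\lambda}(x)\frac{t^n}{n!}$. -}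

module Defs where

open import Level using (Level)
open import Data.Nat using (ℕ; zero; suc)
import Data.Nat as ℕ
open import Data.Nat.Combinatorics using (_C_)
open import Data.Integer using (ℤ; +_; -[1+_])
import Data.Integer as ℤ
open import Algebra.Bundles using (CommutativeRing)

-- Signed Stirling numbers of the first kind:
-- x(x-1)...(x-n+1) = Σ_l S₁ n l x^l, so
-- S₁ (n+1) (l+1) = S₁ n l - n * S₁ n (l+1).
S₁ : ℕ → ℕ → ℤ
S₁ zero    zero    = + 1
S₁ zero    (suc l) = + 0
S₁ (suc n) zero    = + 0
S₁ (suc n) (suc l) = S₁ n l ℤ.- (+ n) ℤ.* S₁ n (suc l)

module _ {c ℓ : Level} (R : CommutativeRing c ℓ) where
  open CommutativeRing R hiding (zero)

  natR : ℕ → Carrier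
  natR zero    = 0#
  natR (suc n) = 1# + natR n

  intR : ℤ → Carrier
  intR (+ n)      = natR n
  intR -[1+ n ]   = - natR (suc n)

  sumTo : ℕ → (ℕ → Carrier) → Carrier
  sumTo zero    f = f 0
  sumTo (suc n) f = sumTo n f + f (suc n)

  dff : Carrier → Carrier → ℕ → Carrier
  dff x lam zero    = 1#
  dff x lam (suc n) = dff x lam n * (x - natR n * lam)

  -- Exponential generating functions are represented by their sequences of
  -- coefficients a n (the series is Σ a n t^n/n!).  Product of EGFs:
  egfMul : (ℕ → Carrier) → (ℕ → Carrier) → ℕ → Carrier
  egfMul a b n = sumTo n (λ k → natR (n C k) * (a k * b (n ℕ.∸ k)))

  egfAddOne : (ℕ → Carrier) → ℕ → Carrier
  egfAddOne a zero    = a 0 + 1#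
  egfAddOne a (suc n) = a (suc n)

  -- composition with log(1+t): if F(t) = Σ a m t^m/m!, then
  -- F(log(1+t)) = Σ_m a m (log(1+t))^m/m! = Σ_n (Σ_m S₁ n m a m) t^n/n!,
  -- using (log(1+t))^m/m! = Σ_n S₁(n,m) t^n/n!.
  egfLog1p : (ℕ → Carrier) → ℕ → Carrier
  egfLog1p a n = sumTo n (λ m → intR (S₁ n m) * a m)

  -- E is the EGF coefficient sequence of
  --   2/((1+λt)^{1/λ}+1) (1+λt)^{x/λ},
  -- characterised by ((1+λt)^{1/λ}+1) · Σ E n t^n/n! = 2 (1+λt)^{x/λ}
  -- (unique solution since 2 is invertible).
  IsDegEuler : Carrier → Carrier → (ℕ → Carrier) → Set ℓ
  IsDegEuler lam x E = ∀ n →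
    egfMul (egfAddOne (dff 1# lam)) E n ≈ (1# + 1#) * dff x lam n

  -- Ch is the EGF coefficient sequence of
  --   2/(1+(1+λ log(1+t))^{1/λ}) (1+λ log(1+t))^{x/λ}.
  IsDegChanghee2 : Carrier → Carrier → (ℕ → Carrier) → Set ℓ
  IsDegChanghee2 lam x Ch = ∀ n →
    egfMul (egfAddOne (egfLog1p (dff 1# lam))) Ch n
      ≈ (1# + 1#) * egfLog1p (dff x lam) n

module Submission where

open import Defs
open import Data.Nat using (ℕ; zero; suc)
open import Relation.Nullary using (¬_)
open import Algebra.Bundles using (CommutativeRing)

import Data.Nat as ℕ
import Data.Nat.Properties as ℕₚ
open import Data.Nat.Combinatorics using (_C_; nCk+nC[k+1]≡[n+1]C[k+1]; k>n⇒nCk≡0)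
open import Data.Integer using (ℤ; +_; -[1+_])
import Data.Integer as ℤ
import Data.Integer.Properties as ℤₚ
open import Data.Sum using (inj₁; inj₂)
import Relation.Binary.PropositionalEquality as ≡
open ≡ using (_≡_)

-- Sequences a stand for exponential generating functions
-- Σ a n tⁿ/n!.  The Euler relation says C(t)·E(t) = 2(1+λt)^{x/λ} with
-- C(t) = (1+λt)^{1/λ} + 1, and the Changhee relation is the same identity
-- after the substitution t ↦ log(1+t).  On coefficients this substitution is
-- the Stirling transform 𝓛 a n = Σₘ S₁(n,m) a m (egfLog1p), whose value on
-- E is exactly the left-hand side of the theorem.
--
-- The central fact is the recursion 𝓛 a (n+1) = 𝓛 (shift a) n − n·𝓛 a n, the
-- coefficient form of (1+t)·(F(log(1+t)))' = F'(log(1+t)); by induction it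
-- makes 𝓛 multiplicative for the EGF product.  Hence 𝓛 E solves the Changhee
-- relation.  The series C(log(1+t)) has constant term 2, a unit.

S₁-above-diagonal : ∀ {n m} → n ℕ.< m → S₁ n m ≡ + 0
S₁-above-diagonal {zero}  {suc l} _ = ≡.refl
S₁-above-diagonal {suc n} {suc l} (ℕ.s≤s n<l)
  rewrite S₁-above-diagonal n<l | S₁-above-diagonal (ℕₚ.m<n⇒m<1+n n<l) =
    ≡.cong (ℤ._-_ (+ 0)) (ℤₚ.*-zeroʳ (+ n))

module StirlingTransform {c ℓ} (R : CommutativeRing c ℓ) where
  open CommutativeRing R hiding (zero)
  open import Relation.Binary.Reasoning.Setoid setoid
  open import Algebra.Properties.Ring ring using (x[y-z]≈xy-xz; [y-z]x≈yx-zx; -‿distribʳ-*)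
  open import Algebra.Properties.AbelianGroup +-abelianGroup using (⁻¹-∙-comm)
  open import Algebra.Properties.Group +-group using (ε⁻¹≈ε; ⁻¹-involutive; ∙-cancelʳ)
  open import Algebra.Properties.Semiring.Mult semiring using (_×_; ×-homo-+; ×1-homo-*)
  open import Algebra.Properties.CommutativeSemigroup +-commutativeSemigroup
    using () renaming (interchange to +-interchange; x∙yz≈y∙xz to +-leftComm)
  open import Algebra.Properties.CommutativeSemigroup *-commutativeSemigroup
    using () renaming (x∙yz≈y∙xz to *-leftComm)
  open import Algebra.Solver.Ring.NaturalCoefficients.Default commutativeSemiring

  ι : ℕ → Carrier
  ι = natR R

  ιℤ : ℤ → Carrier
  ιℤ = intR R

  ∑ : ℕ → (ℕ → Carrier) → Carrier
  ∑ = sumTo R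

  infixl 7 _⋆_
  _⋆_ : (ℕ → Carrier) → (ℕ → Carrier) → ℕ → Carrier
  _⋆_ = egfMul R

  𝓛 : (ℕ → Carrier) → ℕ → Carrier
  𝓛 = egfLog1p R

  two : Carrier
  two = 1# + 1#

  -‿+ : ∀ a b → - (a + b) ≈ - a + - b
  -‿+ a b = sym (⁻¹-∙-comm a b)

  sub-interchange : ∀ a b c d → (a + b) - (c + d) ≈ (a - c) + (b - d)
  sub-interchange a b c d = trans (+-cong refl (-‿+ c d)) (+-interchange a b (- c) (- d))

  sub-cancel-common : ∀ c a b → (c + a) - (c + b) ≈ a - b
  sub-cancel-common c a b =
    trans (sub-interchange c a c b) (trans (+-cong (-‿inverseʳ c) refl) (+-identityˡ _))

  ι≈× : ∀ n → ι n ≈ n × 1#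
  ι≈× zero    = refl
  ι≈× (suc n) = +-cong refl (ι≈× n)

  ι-+ : ∀ m n → ι (m ℕ.+ n) ≈ ι m + ι n
  ι-+ m n = begin
    ι (m ℕ.+ n)      ≈⟨ ι≈× (m ℕ.+ n) ⟩
    (m ℕ.+ n) × 1#   ≈⟨ ×-homo-+ 1# m n ⟩
    m × 1# + n × 1#  ≈⟨ +-cong (ι≈× m) (ι≈× n) ⟨
    ι m + ι n        ∎

  ι-* : ∀ m n → ι (m ℕ.* n) ≈ ι m * ι n
  ι-* m n = begin
    ι (m ℕ.* n)          ≈⟨ ι≈× (m ℕ.* n) ⟩
    (m ℕ.* n) × 1#       ≈⟨ ×1-homo-* m n ⟩
    (m × 1#) * (n × 1#)  ≈⟨ *-cong (ι≈× m) (ι≈× n) ⟨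
    ι m * ι n            ∎

  ιℤ-neg : ∀ z → ιℤ (ℤ.- z) ≈ - ιℤ z
  ιℤ-neg -[1+ n ]   = sym (⁻¹-involutive _)
  ιℤ-neg (+ zero)   = sym ε⁻¹≈ε
  ιℤ-neg (+ suc n)  = refl

  ιℤ-⊖ : ∀ m n → ιℤ (m ℤ.⊖ n) ≈ ι m - ι n
  ιℤ-⊖ m       zero    = sym (trans (+-cong refl ε⁻¹≈ε) (+-identityʳ _))
  ιℤ-⊖ zero    (suc n) = sym (+-identityˡ _)
  ιℤ-⊖ (suc m) (suc n) = begin
    ιℤ (suc m ℤ.⊖ suc n)  ≡⟨ ≡.cong ιℤ (ℤₚ.[1+m]⊖[1+n]≡m⊖n m n) ⟩
    ιℤ (m ℤ.⊖ n)          ≈⟨ ιℤ-⊖ m n ⟩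
    ι m - ι n             ≈⟨ sub-cancel-common 1# (ι m) (ι n) ⟨
    ι (suc m) - ι (suc n) ∎

  ιℤ-+ : ∀ a b → ιℤ (a ℤ.+ b) ≈ ιℤ a + ιℤ b
  ιℤ-+ -[1+ m ] -[1+ n ] = begin
    - ι (suc (suc (m ℕ.+ n)))  ≡⟨ ≡.cong (λ k → - ι (suc k)) (≡.sym (ℕₚ.+-suc m n)) ⟩
    - ι (suc m ℕ.+ suc n)      ≈⟨ -‿cong (ι-+ (suc m) (suc n)) ⟩
    - (ι (suc m) + ι (suc n))  ≈⟨ -‿+ _ _ ⟩
    - ι (suc m) + - ι (suc n)  ∎
  ιℤ-+ -[1+ m ] (+ n)    = trans (ιℤ-⊖ n (suc m)) (+-comm _ _)
  ιℤ-+ (+ m)    -[1+ n ] = ιℤ-⊖ m (suc n)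
  ιℤ-+ (+ m)    (+ n)    = ι-+ m n

  ιℤ-ℕ* : ∀ n z → ιℤ (+ n ℤ.* z) ≈ ι n * ιℤ z
  ιℤ-ℕ* n (+ m)    = trans (reflexive (≡.cong ιℤ (≡.sym (ℤₚ.pos-* n m)))) (ι-* n m)
  ιℤ-ℕ* n -[1+ m ] = begin
    ιℤ (+ n ℤ.* -[1+ m ])          ≡⟨ ≡.cong ιℤ (ℤₚ.-◃n≡-n (n ℕ.* suc m)) ⟩
    ιℤ (ℤ.- (+ (n ℕ.* suc m)))     ≈⟨ ιℤ-neg (+ (n ℕ.* suc m)) ⟩
    - ι (n ℕ.* suc m)              ≈⟨ -‿cong (ι-* n (suc m)) ⟩
    - (ι n * ι (suc m))            ≈⟨ -‿distribʳ-* _ _ ⟩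
    ι n * - ι (suc m)              ∎

  ιℤ-S₁-suc : ∀ n l → ιℤ (S₁ (suc n) (suc l)) ≈ ιℤ (S₁ n l) - ι n * ιℤ (S₁ n (suc l))
  ιℤ-S₁-suc n l = trans (ιℤ-+ (S₁ n l) (ℤ.- (+ n ℤ.* S₁ n (suc l))))
    (+-cong refl (trans (ιℤ-neg (+ n ℤ.* S₁ n (suc l))) (-‿cong (ιℤ-ℕ* n (S₁ n (suc l))))))

  ∑-cong : ∀ n {f g : ℕ → Carrier} → (∀ k → k ℕ.≤ n → f k ≈ g k) → ∑ n f ≈ ∑ n g
  ∑-cong zero    f≈g = f≈g 0 ℕ.z≤n
  ∑-cong (suc n) f≈g =
    +-cong (∑-cong n (λ k k≤n → f≈g k (ℕₚ.m≤n⇒m≤1+n k≤n))) (f≈g (suc n) ℕₚ.≤-refl)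

  ∑-+ : ∀ n (f g : ℕ → Carrier) → ∑ n (λ k → f k + g k) ≈ ∑ n f + ∑ n g
  ∑-+ zero    f g = refl
  ∑-+ (suc n) f g = trans (+-cong (∑-+ n f g) refl) (+-interchange _ _ _ _)

  ∑-sub : ∀ n (f g : ℕ → Carrier) → ∑ n (λ k → f k - g k) ≈ ∑ n f - ∑ n g
  ∑-sub zero    f g = refl
  ∑-sub (suc n) f g = trans (+-cong (∑-sub n f g) refl) (sym (sub-interchange _ _ _ _))

  ∑-*ˡ : ∀ n a (f : ℕ → Carrier) → ∑ n (λ k → a * f k) ≈ a * ∑ n f
  ∑-*ˡ zero    a f = refl
  ∑-*ˡ (suc n) a f = trans (+-cong (∑-*ˡ n a f) refl) (sym (distribˡ a _ _))

  ∑-front : ∀ n (f : ℕ → Carrier) → ∑ (suc n) f ≈ f 0 + ∑ n (λ k → f (suc k))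
  ∑-front zero    f = refl
  ∑-front (suc n) f = trans (+-cong (∑-front n f) refl) (+-assoc _ _ _)

  -- Derivative and Euler operator t·d/dt on exponential generating functions.
  D : (ℕ → Carrier) → ℕ → Carrier
  D a k = a (suc k)

  θ : (ℕ → Carrier) → ℕ → Carrier
  θ a k = ι k * a k

  ⋆-cong : ∀ n {a a′ b b′ : ℕ → Carrier} →
    (∀ k → a k ≈ a′ k) → (∀ k → b k ≈ b′ k) → (a ⋆ b) n ≈ (a′ ⋆ b′) n
  ⋆-cong n a≈a′ b≈b′ = ∑-cong n (λ k _ → *-cong refl (*-cong (a≈a′ k) (b≈b′ _)))

  ⋆-subˡ : ∀ n (a a′ b : ℕ → Carrier) →
    ((λ k → a k - a′ k) ⋆ b) n ≈ (a ⋆ b) n - (a′ ⋆ b) n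
  ⋆-subˡ n a a′ b = trans
    (∑-cong n (λ k _ → trans (*-cong refl ([y-z]x≈yx-zx _ _ _)) (x[y-z]≈xy-xz _ _ _)))
    (∑-sub n _ _)

  ⋆-subʳ : ∀ n (a b b′ : ℕ → Carrier) →
    (a ⋆ (λ k → b k - b′ k)) n ≈ (a ⋆ b) n - (a ⋆ b′) n
  ⋆-subʳ n a b b′ = trans
    (∑-cong n (λ k _ → trans (*-cong refl (x[y-z]≈xy-xz _ _ _)) (x[y-z]≈xy-xz _ _ _)))
    (∑-sub n _ _)

  -- Leibniz rule (ab)′ = a′b + ab′, via Pascal's rule for the binomials.
  ⋆-leibniz : ∀ n (a b : ℕ → Carrier) → (a ⋆ b) (suc n) ≈ (D a ⋆ b) n + (a ⋆ D b) n
  ⋆-leibniz n a b = begin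
    ∑ (suc n) t                       ≈⟨ ∑-front n t ⟩
    t 0 + ∑ n (λ j → t (suc j))       ≈⟨ +-cong refl (trans (∑-cong n pascal) (∑-+ n _ _)) ⟩
    t 0 + ((D a ⋆ b) n + rest)        ≈⟨ +-leftComm (t 0) _ rest ⟩
    (D a ⋆ b) n + (u 0 + rest)        ≈⟨ +-cong refl (∑-front n u) ⟨
    (D a ⋆ b) n + (∑ n u + u (suc n)) ≈⟨ +-cong refl (trans (+-cong refl u-last) (+-identityʳ _)) ⟩
    (D a ⋆ b) n + ∑ n u               ≈⟨ +-cong refl (∑-cong n u-shift) ⟩
    (D a ⋆ b) n + (a ⋆ D b) n         ∎
    where
    t : ℕ → Carrier
    t k = ι (suc n C k) * (a k * b (suc n ℕ.∸ k))
    u : ℕ → Carrier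
    u k = ι (n C k) * (a k * b (suc n ℕ.∸ k))
    rest : Carrier
    rest = ∑ n (λ j → ι (n C suc j) * (a (suc j) * b (n ℕ.∸ j)))
    pascal : ∀ j → j ℕ.≤ n → t (suc j) ≈
      ι (n C j) * (a (suc j) * b (n ℕ.∸ j)) + ι (n C suc j) * (a (suc j) * b (n ℕ.∸ j))
    pascal j _ = trans
      (*-cong (trans (reflexive (≡.cong ι (≡.sym (nCk+nC[k+1]≡[n+1]C[k+1] n j))))
                     (ι-+ (n C j) (n C suc j))) refl)
      (distribʳ _ _ _)
    u-last : u (suc n) ≈ 0#
    u-last = trans (*-cong (reflexive (≡.cong ι (k>n⇒nCk≡0 (ℕₚ.n<1+n n)))) refl) (zeroˡ _)
    u-shift : ∀ k → k ℕ.≤ n → u k ≈ ι (n C k) * (a k * b (suc (n ℕ.∸ k)))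
    u-shift k k≤n = reflexive (≡.cong (λ i → ι (n C k) * (a k * b i)) (ℕₚ.+-∸-assoc 1 k≤n))

  -- t·d/dt is a derivation: k + (n−k) = n in each term of the product.
  θ-derivation : ∀ n (a b : ℕ → Carrier) → (θ a ⋆ b) n + (a ⋆ θ b) n ≈ ι n * (a ⋆ b) n
  θ-derivation n a b = trans (sym (∑-+ n _ _)) (trans (∑-cong n term) (∑-*ˡ n (ι n) _))
    where
    regroup : ∀ p x y u v → p * ((x * u) * v) + p * (u * (y * v)) ≈ (x + y) * (p * (u * v))
    regroup = solve 5 (λ p x y u v →
      p :* ((x :* u) :* v) :+ p :* (u :* (y :* v)) := (x :+ y) :* (p :* (u :* v))) refl
    term : ∀ k → k ℕ.≤ n → ι (n C k) * (θ a k * b (n ℕ.∸ k)) + ι (n C k) * (a k * θ b (n ℕ.∸ k))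
                           ≈ ι n * (ι (n C k) * (a k * b (n ℕ.∸ k)))
    term k k≤n = trans (regroup _ _ _ _ _)
      (*-cong (trans (sym (ι-+ k (n ℕ.∸ k))) (reflexive (≡.cong ι (ℕₚ.m+[n∸m]≡n k≤n)))) refl)

  𝓛-zero : ∀ a → 𝓛 a 0 ≈ a 0
  𝓛-zero a = trans (*-cong (+-identityʳ 1#) refl) (*-identityˡ _)

  𝓛-cong : ∀ n {a b : ℕ → Carrier} → (∀ k → a k ≈ b k) → 𝓛 a n ≈ 𝓛 b n
  𝓛-cong n a≈b = ∑-cong n (λ k _ → *-cong refl (a≈b k))

  𝓛-+ : ∀ n (a b : ℕ → Carrier) → 𝓛 (λ k → a k + b k) n ≈ 𝓛 a n + 𝓛 b n
  𝓛-+ n a b = trans (∑-cong n (λ k _ → distribˡ _ _ _)) (∑-+ n _ _)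

  𝓛-scale : ∀ n x (a : ℕ → Carrier) → 𝓛 (λ k → x * a k) n ≈ x * 𝓛 a n
  𝓛-scale n x a = trans (∑-cong n (λ k _ → *-leftComm _ x _)) (∑-*ˡ n x _)

  𝓛-addOne : ∀ (a : ℕ → Carrier) n → 𝓛 (egfAddOne R a) n ≈ egfAddOne R (𝓛 a) n
  𝓛-addOne a zero    = trans (𝓛-zero (egfAddOne R a)) (+-cong (sym (𝓛-zero a)) refl)
  𝓛-addOne a (suc n) = ∑-cong (suc n) term
    where
    term : ∀ k → k ℕ.≤ suc n → ιℤ (S₁ (suc n) k) * egfAddOne R a k ≈ ιℤ (S₁ (suc n) k) * a k
    term zero    _ = trans (zeroˡ _) (sym (zeroˡ _))
    term (suc k) _ = refl

  -- Shifting the summation index of 𝓛: the terms m = 0 and m = n+1 vanish.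
  -- For n = 0 the shifted sum differs from 𝓛 a 0, but then the factor n is 0.
  𝓛-reindex : ∀ n (a : ℕ → Carrier) →
    ι n * ∑ n (λ m → ιℤ (S₁ n (suc m)) * a (suc m)) ≈ ι n * 𝓛 a n
  𝓛-reindex zero    a = trans (zeroˡ _) (sym (zeroˡ _))
  𝓛-reindex (suc n) a = *-cong refl (begin
    ∑ n t + ιℤ (S₁ (suc n) (suc (suc n))) * a (suc (suc n))  ≈⟨ +-cong refl top-vanishes ⟩
    ∑ n t + 0#                                             ≈⟨ +-identityʳ _ ⟩
    ∑ n t                                                  ≈⟨ +-identityˡ _ ⟨
    0# + ∑ n t                                             ≈⟨ +-cong (zeroˡ (a 0)) refl ⟨
    ιℤ (S₁ (suc n) 0) * a 0 + ∑ n t                        ≈⟨ ∑-front n _ ⟨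
    𝓛 a (suc n)                                            ∎)
    where
    t : ℕ → Carrier
    t m = ιℤ (S₁ (suc n) (suc m)) * a (suc m)
    top-vanishes : ιℤ (S₁ (suc n) (suc (suc n))) * a (suc (suc n)) ≈ 0#
    top-vanishes = trans
      (*-cong (reflexive (≡.cong ιℤ (S₁-above-diagonal (ℕₚ.n<1+n (suc n))))) refl) (zeroˡ _)

  -- The key recursion, the coefficient form of (1+t)·(F∘log(1+t))′ = F′∘log(1+t).
  𝓛-suc : ∀ n (a : ℕ → Carrier) → 𝓛 a (suc n) ≈ 𝓛 (D a) n - ι n * 𝓛 a n
  𝓛-suc n a = begin
    𝓛 a (suc n)                                    ≈⟨ ∑-front n _ ⟩
    0# * a 0 + ∑ n s                               ≈⟨ trans (+-cong (zeroˡ _) refl) (+-identityˡ _) ⟩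
    ∑ n s                                          ≈⟨ ∑-cong n (λ j _ → recurrence j) ⟩
    ∑ n (λ j → ιℤ (S₁ n j) * a (suc j) - ι n * s′ j) ≈⟨ ∑-sub n _ _ ⟩
    𝓛 (D a) n - ∑ n (λ j → ι n * s′ j)             ≈⟨ +-cong refl (-‿cong (∑-*ˡ n (ι n) s′)) ⟩
    𝓛 (D a) n - ι n * ∑ n s′                       ≈⟨ +-cong refl (-‿cong (𝓛-reindex n a)) ⟩
    𝓛 (D a) n - ι n * 𝓛 a n                        ∎
    where
    s : ℕ → Carrier
    s j = ιℤ (S₁ (suc n) (suc j)) * a (suc j)
    s′ : ℕ → Carrier
    s′ j = ιℤ (S₁ n (suc j)) * a (suc j)
    recurrence : ∀ j → s j ≈ ιℤ (S₁ n j) * a (suc j) - ι n * s′ j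
    recurrence j = trans (*-cong (ιℤ-S₁-suc n j) refl)
      (trans ([y-z]x≈yx-zx _ _ _) (+-cong refl (-‿cong (*-assoc _ _ _))))

  𝓛-⋆ : ∀ n (a b : ℕ → Carrier) → 𝓛 (a ⋆ b) n ≈ (𝓛 a ⋆ 𝓛 b) n
  𝓛-⋆ zero    a b = trans (𝓛-zero (a ⋆ b)) (*-cong refl (*-cong (sym (𝓛-zero a)) (sym (𝓛-zero b))))
  𝓛-⋆ (suc n) a b = begin
    𝓛 (a ⋆ b) (suc n)
      ≈⟨ 𝓛-suc n (a ⋆ b) ⟩
    𝓛 (D (a ⋆ b)) n - ι n * 𝓛 (a ⋆ b) n
      ≈⟨ +-cong (𝓛-cong n (λ k → ⋆-leibniz k a b)) (-‿cong (*-cong refl (𝓛-⋆ n a b))) ⟩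
    𝓛 (λ k → (D a ⋆ b) k + (a ⋆ D b) k) n - ι n * (𝓛 a ⋆ 𝓛 b) n
      ≈⟨ +-cong (trans (𝓛-+ n _ _) (+-cong (𝓛-⋆ n (D a) b) (𝓛-⋆ n a (D b))))
                (-‿cong (sym (θ-derivation n (𝓛 a) (𝓛 b)))) ⟩
    ((𝓛 (D a) ⋆ 𝓛 b) n + (𝓛 a ⋆ 𝓛 (D b)) n) - ((θ (𝓛 a) ⋆ 𝓛 b) n + (𝓛 a ⋆ θ (𝓛 b)) n)
      ≈⟨ sub-interchange _ _ _ _ ⟩
    ((𝓛 (D a) ⋆ 𝓛 b) n - (θ (𝓛 a) ⋆ 𝓛 b) n) + ((𝓛 a ⋆ 𝓛 (D b)) n - (𝓛 a ⋆ θ (𝓛 b)) n)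
      ≈⟨ +-cong (⋆-subˡ n (𝓛 (D a)) (θ (𝓛 a)) (𝓛 b)) (⋆-subʳ n (𝓛 a) (𝓛 (D b)) (θ (𝓛 b))) ⟨
    ((λ k → 𝓛 (D a) k - θ (𝓛 a) k) ⋆ 𝓛 b) n + (𝓛 a ⋆ (λ k → 𝓛 (D b) k - θ (𝓛 b) k)) n
      ≈⟨ +-cong (⋆-cong n {b = 𝓛 b} (λ k → sym (𝓛-suc k a)) (λ _ → refl))
                (⋆-cong n {a = 𝓛 a} (λ _ → refl) (λ k → sym (𝓛-suc k b))) ⟩
    (D (𝓛 a) ⋆ 𝓛 b) n + (𝓛 a ⋆ D (𝓛 b)) n
      ≈⟨ ⋆-leibniz n (𝓛 a) (𝓛 b) ⟨
    (𝓛 a ⋆ 𝓛 b) (suc n) ∎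

  -- A series whose constant term is a unit can be cancelled from an EGF product:
  -- the coefficient n of c ⋆ u is c₀·u n plus terms involving only earlier u m.
  ⋆-cancelˡ : ∀ (c u v : ℕ → Carrier) (inv : Carrier) → inv * c 0 ≈ 1# →
    (∀ n → (c ⋆ u) n ≈ (c ⋆ v) n) → ∀ n → u n ≈ v n
  ⋆-cancelˡ c u v inv inv-c₀ c⋆u≈c⋆v n = agree n n ℕₚ.≤-refl
    where
    undo-c₀ : ∀ y → inv * (c 0 * y) ≈ y
    undo-c₀ y = trans (sym (*-assoc inv (c 0) y)) (trans (*-cong inv-c₀ refl) (*-identityˡ y))

    leading : ∀ y → ι 1 * (c 0 * y) ≈ c 0 * y
    leading y = trans (*-cong (+-identityʳ 1#) refl) (*-identityˡ _)

    cancel-c₀ : ∀ {y z} → ι 1 * (c 0 * y) ≈ ι 1 * (c 0 * z) → y ≈ z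
    cancel-c₀ {y} {z} e = begin
      y                  ≈⟨ undo-c₀ y ⟨
      inv * (c 0 * y)    ≈⟨ *-cong refl (trans (sym (leading y)) (trans e (leading z))) ⟩
      inv * (c 0 * z)    ≈⟨ undo-c₀ z ⟩
      z                  ∎

    agree-suc : ∀ n → (∀ m → m ℕ.≤ n → u m ≈ v m) → u (suc n) ≈ v (suc n)
    agree-suc n ih = cancel-c₀ (∙-cancelʳ (rest u) _ _ (begin
      ι 1 * (c 0 * u (suc n)) + rest u ≈⟨ ∑-front n _ ⟨
      (c ⋆ u) (suc n)                  ≈⟨ c⋆u≈c⋆v (suc n) ⟩
      (c ⋆ v) (suc n)                  ≈⟨ ∑-front n _ ⟩
      ι 1 * (c 0 * v (suc n)) + rest v ≈⟨ +-cong refl rest-agree ⟨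
      ι 1 * (c 0 * v (suc n)) + rest u ∎))
      where
      rest : (ℕ → Carrier) → Carrier
      rest w = ∑ n (λ j → ι (suc n C suc j) * (c (suc j) * w (n ℕ.∸ j)))
      rest-agree : rest u ≈ rest v
      rest-agree = ∑-cong n (λ j _ → *-cong refl (*-cong refl (ih (n ℕ.∸ j) (ℕₚ.m∸n≤m n j))))

    agree : ∀ n m → m ℕ.≤ n → u m ≈ v m
    agree zero    .zero ℕ.z≤n = cancel-c₀ (c⋆u≈c⋆v 0)
    agree (suc n) m     m≤1+n with ℕₚ.m≤n⇒m<n∨m≡n m≤1+n
    ... | inj₁ (ℕ.s≤s m≤n) = agree n m m≤n
    ... | inj₂ ≡.refl      = agree-suc n (agree n)

  euler⇒changhee : ∀ lam x (E : ℕ → Carrier) →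
    IsDegEuler R lam x E → IsDegChanghee2 R lam x (𝓛 E)
  euler⇒changhee lam x E euler n = begin
    (egfAddOne R (𝓛 d₁) ⋆ 𝓛 E) n   ≈⟨ ⋆-cong n {b = 𝓛 E} (λ k → sym (𝓛-addOne d₁ k)) (λ _ → refl) ⟩
    (𝓛 (egfAddOne R d₁) ⋆ 𝓛 E) n   ≈⟨ 𝓛-⋆ n _ _ ⟨
    𝓛 (egfAddOne R d₁ ⋆ E) n       ≈⟨ 𝓛-cong n euler ⟩
    𝓛 (λ k → two * dₓ k) n         ≈⟨ 𝓛-scale n two dₓ ⟩
    two * 𝓛 dₓ n                   ∎
    where
    d₁ : ℕ → Carrier
    d₁ = dff R 1# lam
    dₓ : ℕ → Carrier
    dₓ = dff R x lam

  -- When 2 is invertible the Changhee relation has at most one solution,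
  -- since C(log(1+t)) has constant term 1 + 1.
  changhee-unique : ∀ lam x (half : Carrier) → half * two ≈ 1# → ∀ (U V : ℕ → Carrier) →
    IsDegChanghee2 R lam x U → IsDegChanghee2 R lam x V → ∀ n → U n ≈ V n
  changhee-unique lam x half half-two U V changheeU changheeV =
    ⋆-cancelˡ (egfAddOne R (𝓛 d₁)) U V half half-c₀ (λ n → trans (changheeU n) (sym (changheeV n)))
    where
    d₁ : ℕ → Carrier
    d₁ = dff R 1# lam
    half-c₀ : half * (𝓛 d₁ 0 + 1#) ≈ 1#
    half-c₀ = trans (*-cong refl (+-cong (𝓛-zero d₁) refl)) half-two

-- The left-hand side is the
-- Stirling transform of the Euler sequence, which solves the Changhee relation,
-- and that relation has a unique solution.
theorem2p2 : ∀ {c ℓ} (R : CommutativeRing c ℓ) →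
    let open CommutativeRing R in
    (half : Carrier) → (1# + 1#) * half ≈ 1# →
    (lam x : Carrier) → ¬ (lam ≈ 0#) →
    (E Ch : ℕ → Carrier) →
    IsDegEuler R lam x E → IsDegChanghee2 R lam x Ch →
    (n : ℕ) → sumTo R n (λ l → intR R (S₁ n l) * E l) ≈ Ch n
theorem2p2 R half two-half lam x _ E Ch euler changhee =
  changhee-unique lam x half (trans (*-comm half _) two-half)
    (𝓛 E) Ch (euler⇒changhee lam x E euler) changhee
  where
  open CommutativeRing R using (*-comm; trans)
  open StirlingTransform R
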